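{- Let $F$ be either a field $\mathbb{Q}$ or $\mathbb{Z}/m\mathbb{Z}$ for a positive integer $m$, and let $k$ be a positive integer. For any subset $R$ of $F^k$ there exists a subset $R_0\subset R$ with $\operatorname{card}(R_0)\le g(F)k$ and $\langle R_0\rangle=\langle R\rangle$.
   Context: $\langle X\rangle$ denotes the $F$-submodule generated by $X$. $g(F)=1$ if $F$ is a field, and $g(F)$ is the number of distinct prime divisors of $m$ if $F=\mathbb{Z}/m\mathbb{Z}$. -}

module Defs where

open import Data.Nat as ℕ using (ℕ; zero; suc; NonZero; _≤_)
open import Data.Nat.DivMod using (_mod_)
open import Data.Nat.Divisibility using (_∣?_)
open import Data.Nat.Primality using (prime?)
open import Data.Fin using (Fin; toℕ)
open import Data.Rational as Q using (ℚ; 0ℚ)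
open import Data.Vec using (Vec; replicate; zipWith; map)
open import Data.List using (List; []; _∷_; length; filter; upTo)
open import Data.List.Relation.Unary.All using (All)
open import Data.List.Membership.Propositional using (_∈_)
open import Data.Product using (_×_; _,_; proj₂; ∃)
open import Relation.Nullary.Decidable using (_×-dec_)
open import Relation.Binary.PropositionalEquality using (_≡_)
open import Function.Bundles using (_⇔_)

record Coeffs : Set₁ where
  field
    Carrier : Set
    0#      : Carrier
    _+_     : Carrier → Carrier → Carrier
    _*_     : Carrier → Carrier → Carrier

ℚ-coeffs : Coeffs
ℚ-coeffs = record { Carrier = ℚ ; 0# = 0ℚ ; _+_ = Q._+_ ; _*_ = Q._*_ }

Zmod : (m : ℕ) → .{{_ : NonZero m}} → Coeffs
Zmod m = record
  { Carrier = Fin m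
  ; 0#      = 0 mod m
  ; _+_     = λ a b → (toℕ a ℕ.+ toℕ b) mod m
  ; _*_     = λ a b → (toℕ a ℕ.* toℕ b) mod m
  }

numPrimeDivisors : ℕ → ℕ
numPrimeDivisors m = length (filter (λ p → prime? p ×-dec (p ∣? m)) (upTo (suc m)))

module _ (F : Coeffs) where
  open Coeffs F

  zeroV : ∀ {k} → Vec Carrier k
  zeroV = replicate _ 0#

  addV : ∀ {k} → Vec Carrier k → Vec Carrier k → Vec Carrier k
  addV = zipWith _+_

  smulV : ∀ {k} → Carrier → Vec Carrier k → Vec Carrier k
  smulV c = map (c *_)

  linComb : ∀ {k} → List (Carrier × Vec Carrier k) → Vec Carrier k
  linComb []             = zeroV
  linComb ((c , v) ∷ cs) = addV (smulV c v) (linComb cs)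

  InSpan : ∀ {k} → (Vec Carrier k → Set) → Vec Carrier k → Set
  InSpan X x = ∃ λ (cs : List (Carrier × Vec Carrier _)) →
                 All (λ p → X (proj₂ p)) cs × linComb cs ≡ x

  SmallGenerating : (g k : ℕ) → Set₁
  SmallGenerating g k =
    (R : Vec Carrier k → Set) →
    ∃ λ (R₀ : List (Vec Carrier k)) →
      All R R₀ × length R₀ ≤ g ℕ.* k ×
      (∀ x → InSpan (_∈ R₀) x ⇔ InSpan R x)

module Submission where

-- The case k = 1 implies all k, over any coefficient ring with the commutative-ring
-- laws (LinearAlgebra.small-generating). For R ⊆ Fᵏ⁺¹ choose g vectors rs of R whose
-- first coordinates generate those of R; then every r ∈ R is (0, w) + v with v ∈ ⟨rs⟩.
-- The residual vectors w form a subset of Fᵏ with g·k generators by induction, and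
-- lifting them back to R gives g·(k+1) generators in all. The bookkeeping rests on the
-- fact that linear maps commute with spans (span-image⁺, span-image⁻).
--
-- For k = 1 a subset S ⊆ F needs at most g members generating the ideal ⟨S⟩. Over ℚ
-- one nonzero member suffices (Rationals). Over ℤ/mℤ (Residues) the ideal is generated
-- by the class of D = gcd(m, S) and, by Bézout, by any members of S whose gcd with m
-- is D; one member not divisible by p·D for each prime p ∣ m suffices
-- (NumberTheory.gcd-sublist). Excluded middle decides membership in the arbitrary R.

open import Defs
open import Level using (0ℓ)
open import Axiom.ExcludedMiddle using (ExcludedMiddle)
open import Data.Nat as ℕ using (ℕ; NonZero; _<_; _≤_; z≤n; s≤s)
import Data.Nat.Properties as ℕP
open import Data.Vec using (Vec; []; _∷_)
open import Data.List as L using (List; []; _∷_; length; _++_)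
import Data.List.Properties as LP
open import Data.List.Relation.Unary.All as All using (All; []; _∷_)
import Data.List.Relation.Unary.All.Properties as AllP
open import Data.List.Relation.Unary.Any using (Any; here; there)
open import Data.List.Membership.Propositional using (_∈_; find)
open import Data.List.Membership.Propositional.Properties using (∈-++⁺ˡ; ∈-++⁺ʳ)
open import Data.Product using (_×_; ∃; _,_; map₁)
open import Data.Sum as Sum using (_⊎_; inj₁; inj₂)
open import Data.Empty using (⊥-elim)
open import Relation.Nullary using (¬_; Dec; yes; no)
open import Relation.Binary.PropositionalEquality
  using (_≡_; _≢_; refl; sym; trans; cong; cong₂; subst; module ≡-Reasoning)
open import Function.Bundles using (mk⇔; Equivalence)
import Data.Rational

choose : {A B : Set} {Q : A → B → Set} (xs : List A) → All (λ x → ∃ (Q x)) xs →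
         ∃ λ ys → length ys ≡ length xs ×
           (∀ {x} → x ∈ xs → ∃ λ y → y ∈ ys × Q x y) × All (λ y → ∃ λ x → Q x y) ys
choose [] [] = [] , refl , (λ ()) , []
choose {Q = Q} (x ∷ xs) ((y , q) ∷ qs) with choose xs qs
... | ys , |ys| , found , valid = y ∷ ys , cong ℕ.suc |ys| , found′ , (x , q) ∷ valid
  where
  found′ : ∀ {x′} → x′ ∈ x ∷ xs → ∃ λ y′ → y′ ∈ y ∷ ys × Q x′ y′
  found′ (here refl) = y , here refl , q
  found′ (there x′∈) with found x′∈
  ... | y′ , y′∈ , q′ = y′ , there y′∈ , q′

counterexamples : {A B : Set} {P : A → B → Set} → (∀ p x → Dec (P p x)) →
  (xs : List B) (ps : List A) →
  ∃ λ ys → (∀ {y} → y ∈ ys → y ∈ xs) × length ys ≤ length ps ×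
           (∀ {p} → p ∈ ps → All (P p) xs ⊎ Any (λ y → ¬ P p y) ys)
counterexamples P? xs [] = [] , (λ ()) , z≤n , λ ()
counterexamples P? xs (p ∷ ps) with counterexamples P? xs ps | All.all? (P? p) xs
... | ys , ys⊆xs , |ys|≤ , tested | yes all-pass =
  ys , ys⊆xs , ℕP.m≤n⇒m≤1+n |ys|≤ ,
  λ { (here refl) → inj₁ all-pass ; (there q∈) → tested q∈ }
... | ys , ys⊆xs , |ys|≤ , tested | no ¬all-pass
  with find (AllP.¬All⇒Any¬ (P? p) xs ¬all-pass)
...   | y , y∈xs , fails =
  y ∷ ys , (λ { (here refl) → y∈xs ; (there y′∈) → ys⊆xs y′∈ }) , s≤s |ys|≤ ,
  λ { (here refl) → inj₂ (here fails)
    ; (there q∈) → Sum.map₂ there (tested q∈) }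

record CommRingLaws (F : Coeffs) : Set where
  open Coeffs F
  field
    -_         : Carrier → Carrier
    1#         : Carrier
    +-assoc    : ∀ x y z → (x + y) + z ≡ x + (y + z)
    +-comm     : ∀ x y → x + y ≡ y + x
    +-identityˡ : ∀ x → 0# + x ≡ x
    -‿inverseˡ : ∀ x → (- x) + x ≡ 0#
    *-assoc    : ∀ x y z → (x * y) * z ≡ x * (y * z)
    *-comm     : ∀ x y → x * y ≡ y * x
    *-identityˡ : ∀ x → 1# * x ≡ x
    distribʳ   : ∀ x y z → (y + z) * x ≡ (y * x) + (z * x)
    *-zeroˡ    : ∀ x → 0# * x ≡ 0#

module LinearAlgebra (F : Coeffs) (laws : CommRingLaws F) where
  open Coeffs F
  open CommRingLaws laws

  Vc : ℕ → Set
  Vc = Vec Carrier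

  Span : ∀ {k} → (Vc k → Set) → Vc k → Set
  Span = InSpan F

  add : ∀ {k} → Vc k → Vc k → Vc k
  add = addV F

  smul : ∀ {k} → Carrier → Vc k → Vc k
  smul = smulV F

  zv : ∀ {k} → Vc k
  zv = zeroV F

  lc : ∀ {k} → List (Carrier × Vc k) → Vc k
  lc = linComb F

  sub : ∀ {k} → Vc k → Vc k → Vc k
  sub u v = add u (smul (- 1#) v)

  *-zeroʳ : ∀ x → x * 0# ≡ 0#
  *-zeroʳ x = trans (*-comm x 0#) (*-zeroˡ x)

  distribˡ : ∀ x y z → x * (y + z) ≡ (x * y) + (x * z)
  distribˡ x y z = begin
    x * (y + z)     ≡⟨ *-comm x (y + z) ⟩
    (y + z) * x     ≡⟨ distribʳ x y z ⟩
    (y * x) + (z * x) ≡⟨ cong₂ _+_ (*-comm y x) (*-comm z x) ⟩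
    (x * y) + (x * z) ∎
    where open ≡-Reasoning

  minus-one-cancel : ∀ x → ((- 1#) * x) + x ≡ 0#
  minus-one-cancel x = begin
    ((- 1#) * x) + x        ≡⟨ cong (((- 1#) * x) +_) (sym (*-identityˡ x)) ⟩
    ((- 1#) * x) + (1# * x) ≡⟨ sym (distribʳ x (- 1#) 1#) ⟩
    ((- 1#) + 1#) * x     ≡⟨ cong (_* x) (-‿inverseˡ 1#) ⟩
    0# * x                ≡⟨ *-zeroˡ x ⟩
    0#                    ∎
    where open ≡-Reasoning

  add-assoc : ∀ {k} (u v w : Vc k) → add (add u v) w ≡ add u (add v w)
  add-assoc [] [] [] = refl
  add-assoc (a ∷ u) (b ∷ v) (c ∷ w) = cong₂ _∷_ (+-assoc a b c) (add-assoc u v w)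

  add-comm : ∀ {k} (u v : Vc k) → add u v ≡ add v u
  add-comm [] [] = refl
  add-comm (a ∷ u) (b ∷ v) = cong₂ _∷_ (+-comm a b) (add-comm u v)

  add-identityˡ : ∀ {k} (u : Vc k) → add zv u ≡ u
  add-identityˡ [] = refl
  add-identityˡ (a ∷ u) = cong₂ _∷_ (+-identityˡ a) (add-identityˡ u)

  add-identityʳ : ∀ {k} (u : Vc k) → add u zv ≡ u
  add-identityʳ u = trans (add-comm u zv) (add-identityˡ u)

  smul-distrib : ∀ {k} c (u v : Vc k) → smul c (add u v) ≡ add (smul c u) (smul c v)
  smul-distrib c [] [] = refl
  smul-distrib c (a ∷ u) (b ∷ v) = cong₂ _∷_ (distribˡ c a b) (smul-distrib c u v)

  smul-assoc : ∀ {k} a b (u : Vc k) → smul a (smul b u) ≡ smul (a * b) u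
  smul-assoc a b [] = refl
  smul-assoc a b (x ∷ u) = cong₂ _∷_ (sym (*-assoc a b x)) (smul-assoc a b u)

  smul-zero : ∀ {k} c → smul {k} c zv ≡ zv
  smul-zero {ℕ.zero} c = refl
  smul-zero {ℕ.suc k} c = cong₂ _∷_ (*-zeroʳ c) (smul-zero c)

  smul-one : ∀ {k} (u : Vc k) → smul 1# u ≡ u
  smul-one [] = refl
  smul-one (x ∷ u) = cong₂ _∷_ (*-identityˡ x) (smul-one u)

  minus-cancel : ∀ {k} (u : Vc k) → add (smul (- 1#) u) u ≡ zv
  minus-cancel [] = refl
  minus-cancel (x ∷ u) = cong₂ _∷_ (minus-one-cancel x) (minus-cancel u)

  sub-add : ∀ {k} (u v : Vc k) → add (sub u v) v ≡ u
  sub-add u v = begin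
    add (add u (smul (- 1#) v)) v   ≡⟨ add-assoc u _ v ⟩
    add u (add (smul (- 1#) v) v)   ≡⟨ cong (add u) (minus-cancel v) ⟩
    add u zv                        ≡⟨ add-identityʳ u ⟩
    u                               ∎
    where open ≡-Reasoning

  add-sub : ∀ {k} (u v : Vc k) → sub (add u v) v ≡ u
  add-sub u v = begin
    add (add u v) (smul (- 1#) v)   ≡⟨ add-assoc u v _ ⟩
    add u (add v (smul (- 1#) v))   ≡⟨ cong (add u) (add-comm v _) ⟩
    add u (add (smul (- 1#) v) v)   ≡⟨ cong (add u) (minus-cancel v) ⟩
    add u zv                        ≡⟨ add-identityʳ u ⟩
    u                               ∎
    where open ≡-Reasoning

  add≡⇒sub : ∀ {k} {u v w : Vc k} → add u v ≡ w → u ≡ sub w v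
  add≡⇒sub {u = u} {v} refl = sym (add-sub u v)

  lc-++ : ∀ {k} (cs ds : List (Carrier × Vc k)) → lc (cs ++ ds) ≡ add (lc cs) (lc ds)
  lc-++ [] ds = sym (add-identityˡ _)
  lc-++ ((c , v) ∷ cs) ds =
    trans (cong (add (smul c v)) (lc-++ cs ds)) (sym (add-assoc _ _ _))

  lc-scale : ∀ {k} a (cs : List (Carrier × Vc k)) →
             lc (L.map (map₁ (a *_)) cs) ≡ smul a (lc cs)
  lc-scale a [] = sym (smul-zero a)
  lc-scale a ((c , v) ∷ cs) =
    trans (cong₂ add (sym (smul-assoc a c v)) (lc-scale a cs))
          (sym (smul-distrib a (smul c v) (lc cs)))

  span-zero : ∀ {k} {X : Vc k → Set} → Span X zv
  span-zero = [] , [] , refl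

  span-elem : ∀ {k} {X : Vc k → Set} {u} → X u → Span X u
  span-elem {u = u} Xu =
    (1# , u) ∷ [] , Xu ∷ [] , trans (add-identityʳ _) (smul-one u)

  span-add : ∀ {k} {X : Vc k → Set} {u v} → Span X u → Span X v → Span X (add u v)
  span-add (cs , Xcs , refl) (ds , Xds , refl) =
    cs ++ ds , AllP.++⁺ Xcs Xds , lc-++ cs ds

  span-smul : ∀ {k} {X : Vc k → Set} a {u} → Span X u → Span X (smul a u)
  span-smul a (cs , Xcs , refl) =
    L.map (map₁ (a *_)) cs , AllP.map⁺ Xcs , lc-scale a cs

  span-sub : ∀ {k} {X : Vc k → Set} {u v} → Span X u → Span X v → Span X (sub u v)
  span-sub su sv = span-add su (span-smul (- 1#) sv)

  span-trans : ∀ {k} {X Y : Vc k → Set} → (∀ y → X y → Span Y y) →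
               ∀ {x} → Span X x → Span Y x
  span-trans X⊆Y ([] , [] , refl) = span-zero
  span-trans X⊆Y ((c , v) ∷ cs , Xv ∷ Xcs , refl) =
    span-add (span-smul c (X⊆Y v Xv)) (span-trans X⊆Y (cs , Xcs , refl))

  record Linear {a b} (f : Vc a → Vc b) : Set where
    field
      map-zero : f zv ≡ zv
      map-add  : ∀ u v → f (add u v) ≡ add (f u) (f v)
      map-smul : ∀ c u → f (smul c u) ≡ smul c (f u)

  Image : ∀ {a b} → (Vc a → Vc b) → (Vc a → Set) → Vc b → Set
  Image f Y y = ∃ λ z → Y z × f z ≡ y

  span-image⁺ : ∀ {a b} {f : Vc a → Vc b} {Y : Vc a → Set} → Linear f →
                ∀ {u} → Span Y u → Span (Image f Y) (f u)
  span-image⁺ lin ([] , [] , refl) = subst (Span _) (sym map-zero) span-zero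
    where open Linear lin
  span-image⁺ lin ((c , v) ∷ cs , Yv ∷ Ycs , refl) =
    subst (Span _) (sym (trans (map-add _ _) (cong (λ z → add z _) (map-smul c v))))
      (span-add (span-smul c (span-elem (v , Yv , refl)))
                (span-image⁺ lin (cs , Ycs , refl)))
    where open Linear lin

  span-image⁻ : ∀ {a b} {f : Vc a → Vc b} {Y : Vc a → Set} → Linear f →
                ∀ {x} → Span (Image f Y) x → Image f (Span Y) x
  span-image⁻ lin ([] , [] , refl) = zv , span-zero , map-zero
    where open Linear lin
  span-image⁻ lin ((c , y) ∷ cs , (z , Yz , refl) ∷ Ycs , refl)
    with span-image⁻ lin (cs , Ycs , refl)
  ... | v , sv , fv≡ =
    add (smul c z) v , span-add (span-smul c (span-elem Yz)) sv ,
    trans (map-add _ _) (cong₂ add (map-smul c z) fv≡)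
    where open Linear lin

  first : ∀ {k} → Vc (ℕ.suc k) → Vc 1
  first (a ∷ _) = a ∷ []

  first-linear : ∀ {k} → Linear (first {k})
  first-linear = record
    { map-zero = refl
    ; map-add  = λ { (a ∷ u) (b ∷ v) → refl }
    ; map-smul = λ { c (a ∷ u) → refl } }

  cons0 : ∀ {k} → Vc k → Vc (ℕ.suc k)
  cons0 w = 0# ∷ w

  cons0-linear : ∀ {k} → Linear (cons0 {k})
  cons0-linear = record
    { map-zero = refl
    ; map-add  = λ u v → cong (_∷ add u v) (sym (+-identityˡ 0#))
    ; map-smul = λ c u → cong (_∷ smul c u) (sym (*-zeroʳ c)) }

  first-agree : ∀ {k} (u v : Vc (ℕ.suc k)) → first u ≡ first v →
                ∃ λ w → u ≡ add (cons0 w) v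
  first-agree (a ∷ u) (.a ∷ v) refl =
    sub u v , cong₂ _∷_ (sym (+-identityˡ a)) (sym (sub-add u v))

  Residual : ∀ {k} → (Vc (ℕ.suc k) → Set) → List (Vc (ℕ.suc k)) → Vc k → Set
  Residual R rs w = ∃ λ r → R r × ∃ λ v → Span (_∈ rs) v × r ≡ add (cons0 w) v

  extend : ∀ {g k} → SmallGenerating F g 1 → SmallGenerating F g k →
           SmallGenerating F g (ℕ.suc k)
  extend {g} {k} base ih R
    with base (Image first R)
  ... | H₀ , H₀⊆H , |H₀|≤ , spanH₀
    with choose H₀ H₀⊆H
  ... | rs , |rs|≡ , liftH₀ , rs⊆R
    with ih (Residual R rs)
  ... | ws , ws⊆W , |ws|≤ , spanWs
    with choose ws ws⊆W
  ... | rws , |rws|≡ , liftWs , rws⊆R =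
    rs ++ rws , R₀⊆R , length-R₀ , λ x → mk⇔ (span-trans R₀⊆⟨R⟩) (span-trans R⊆⟨R₀⟩)
    where
    R₀ = rs ++ rws

    R₀⊆R : All R R₀
    R₀⊆R = AllP.++⁺ (All.map (λ { (_ , Rr , _) → Rr }) rs⊆R)
                    (All.map (λ { (_ , Rr , _) → Rr }) rws⊆R)

    R₀⊆⟨R⟩ : ∀ y → y ∈ R₀ → Span R y
    R₀⊆⟨R⟩ y y∈ = span-elem (All.lookup R₀⊆R y∈)

    length-R₀ : length R₀ ≤ g ℕ.* ℕ.suc k
    length-R₀ = begin
      length (rs ++ rws)       ≡⟨ LP.length-++ rs ⟩
      length rs ℕ.+ length rws ≡⟨ cong₂ ℕ._+_ |rs|≡ |rws|≡ ⟩
      length H₀ ℕ.+ length ws  ≤⟨ ℕP.+-mono-≤ (subst (length H₀ ≤_) (ℕP.*-identityʳ g) |H₀|≤) |ws|≤ ⟩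
      g ℕ.+ g ℕ.* k            ≡⟨ ℕP.*-suc g k ⟨
      g ℕ.* ℕ.suc k            ∎
      where open ℕP.≤-Reasoning

    rs⊆⟨R₀⟩ : ∀ {v} → Span (_∈ rs) v → Span (_∈ R₀) v
    rs⊆⟨R₀⟩ = span-trans (λ y y∈ → span-elem (∈-++⁺ˡ y∈))

    H₀⊆⟨first-rs⟩ : ∀ y → y ∈ H₀ → Span (Image first (_∈ rs)) y
    H₀⊆⟨first-rs⟩ y y∈ with liftH₀ y∈
    ... | r , r∈ , _ , first-r = span-elem (r , r∈ , first-r)

    decompose : ∀ {r} → R r → ∃ λ w → ∃ λ v → Span (_∈ rs) v × r ≡ add (cons0 w) v
    decompose {r} Rr
      with span-image⁻ first-linear (span-trans H₀⊆⟨first-rs⟩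
             (Equivalence.from (spanH₀ (first r)) (span-elem (r , Rr , refl))))
    ... | v , sv , first-v with first-agree r v (sym first-v)
    ... | w , eq = w , v , sv , eq

    cons0-ws⊆⟨R₀⟩ : ∀ u → Image cons0 (_∈ ws) u → Span (_∈ R₀) u
    cons0-ws⊆⟨R₀⟩ u (w , w∈ , refl) with liftWs w∈
    ... | r , r∈ , _ , v , sv , eq =
      subst (Span _) (trans (cong (λ z → sub z v) eq) (add-sub (cons0 w) v))
        (span-sub (span-elem (∈-++⁺ʳ rs r∈)) (rs⊆⟨R₀⟩ sv))

    R⊆⟨R₀⟩ : ∀ r → R r → Span (_∈ R₀) r
    R⊆⟨R₀⟩ r Rr with decompose Rr
    ... | w , v , sv , eq =
      subst (Span _) (sym eq) (span-add (span-trans cons0-ws⊆⟨R₀⟩ (span-image⁺ cons0-linear w∈⟨ws⟩))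
                                        (rs⊆⟨R₀⟩ sv))
      where
      w∈⟨ws⟩ : Span (_∈ ws) w
      w∈⟨ws⟩ = Equivalence.from (spanWs w) (span-elem (r , Rr , v , sv , eq))

  small-generating : ∀ g → SmallGenerating F g 1 → ∀ k → SmallGenerating F g k
  small-generating g base ℕ.zero R =
    [] , [] , z≤n , λ { [] → mk⇔ (λ _ → span-zero) (λ _ → span-zero) }
  small-generating g base (ℕ.suc k) = extend {g} base (small-generating g base k)

-- F = ℚ: a field, so each nonzero vector of ℚ¹ spans ℚ¹.
module Rationals where
  open Data.Rational using (1ℚ; _*_; 1/_; -_; ≢-nonZero)
  open import Data.Rational.Properties

  ℚ-laws : CommRingLaws ℚ-coeffs
  ℚ-laws = record
    { -_ = -_ ; 1# = 1ℚ
    ; +-assoc = +-assoc ; +-comm = +-comm ; +-identityˡ = +-identityˡ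
    ; -‿inverseˡ = +-inverseˡ ; *-assoc = *-assoc ; *-comm = *-comm
    ; *-identityˡ = *-identityˡ ; distribʳ = *-distribʳ-+ ; *-zeroˡ = *-zeroˡ }

  open LinearAlgebra ℚ-coeffs ℚ-laws

  multiple-of-nonzero : ∀ (r x : Vc 1) → r ≢ zv → ∃ λ c → smul c r ≡ x
  multiple-of-nonzero (a ∷ []) (c ∷ []) r≢0 = c * 1/ a , cong (_∷ []) (begin
    (c * 1/ a) * a   ≡⟨ *-assoc c (1/ a) a ⟩
    c * (1/ a * a)   ≡⟨ cong (c *_) (*-inverseˡ a) ⟩
    c * 1ℚ           ≡⟨ *-identityʳ c ⟩
    c                ∎)
    where
    open ≡-Reasoning
    instance _ = ≢-nonZero (λ a≡0 → r≢0 (cong (_∷ []) a≡0))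

  ℚ-small-generating₁ : ExcludedMiddle 0ℓ → SmallGenerating ℚ-coeffs 1 1
  ℚ-small-generating₁ em R with em {∃ λ r → R r × r ≢ zv}
  ... | yes (r , Rr , r≢0) =
    r ∷ [] , Rr ∷ [] , s≤s z≤n ,
    λ x → mk⇔ (span-trans (λ { _ (here refl) → span-elem Rr }))
              (λ _ → let c , cr≡x = multiple-of-nonzero r x r≢0 in
                     subst (Span _) cr≡x (span-smul c (span-elem (here refl))))
  ... | no no-nonzero =
    [] , [] , z≤n ,
    λ x → mk⇔ (span-trans (λ _ ()))
              (span-trans (λ y Ry → subst (Span _) (sym (zero-vector Ry)) span-zero))
    where
    zero-vector : ∀ {y} → R y → y ≡ zv
    zero-vector {y} Ry with em {y ≡ zv}
    ... | yes y≡0 = y≡0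
    ... | no y≢0 = ⊥-elim (no-nonzero (y , Ry , y≢0))

module NumberTheory where
  open import Data.Nat.Divisibility
  open import Data.Nat.GCD using (gcd; gcd[m,n]∣m; gcd[m,n]∣n; gcd-greatest)
  open import Data.Nat.Primality using (Prime; prime⇒nonTrivial)
  open import Data.Nat.Primality.Factorisation using (factorise; PrimeFactorisation)
  open import Data.Nat.ListAction using (product)

  gcdAll : ℕ → List ℕ → ℕ
  gcdAll n [] = n
  gcdAll n (x ∷ xs) = gcd x (gcdAll n xs)

  gcdAll∣n : ∀ n xs → gcdAll n xs ∣ n
  gcdAll∣n n [] = ∣-refl
  gcdAll∣n n (x ∷ xs) = ∣-trans (gcd[m,n]∣n x _) (gcdAll∣n n xs)

  gcdAll∣∈ : ∀ n {xs x} → x ∈ xs → gcdAll n xs ∣ x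
  gcdAll∣∈ n (here refl) = gcd[m,n]∣m _ _
  gcdAll∣∈ n {y ∷ xs} (there x∈) = ∣-trans (gcd[m,n]∣n y (gcdAll n xs)) (gcdAll∣∈ n x∈)

  gcdAll-greatest : ∀ {c n} xs → c ∣ n → All (c ∣_) xs → c ∣ gcdAll n xs
  gcdAll-greatest [] c∣n [] = c∣n
  gcdAll-greatest (x ∷ xs) c∣n (c∣x ∷ c∣xs) = gcd-greatest c∣x (gcdAll-greatest xs c∣n c∣xs)

  gcdAll≢0 : ∀ {n} xs → n ≢ 0 → gcdAll n xs ≢ 0
  gcdAll≢0 {n} xs n≢0 g≡0 = n≢0 (0∣⇒≡0 (subst (_∣ n) g≡0 (gcdAll∣n n xs)))

  prime-factor : ∀ t → t ≢ 0 → t ≢ 1 → ∃ λ p → Prime p × p ∣ t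
  prime-factor t t≢0 t≢1 =
    first-factor (factors f) (PrimeFactorisation.isFactorisation f)
                 (PrimeFactorisation.factorsPrime f)
    where
    instance _ = ℕ.≢-nonZero t≢0
    f = factorise t
    open PrimeFactorisation using (factors)
    first-factor : ∀ ps → t ≡ product ps → All Prime ps → ∃ λ p → Prime p × p ∣ t
    first-factor [] t≡1 _ = ⊥-elim (t≢1 t≡1)
    first-factor (p ∷ ps) t≡ (pp ∷ _) = p , pp , subst (p ∣_) (sym t≡) (m∣m*n _)

  prime-multiple-∤ : ∀ {p d} → Prime p → d ≢ 0 → ¬ (p ℕ.* d ∣ d)
  prime-multiple-∤ {p} {d} pp d≢0 = >⇒∤ (subst (d <_) (ℕP.*-comm d p) (ℕP.m<m*n d p p>1))
    where
    instance _ = ℕ.≢-nonZero d≢0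
    p>1 : 1 < p
    p>1 = ℕ.nonTrivial⇒n>1 p {{prime⇒nonTrivial pp}}

  divisor-tight : ∀ {d g} → g ≢ 0 → d ∣ g → (∀ {p} → Prime p → ¬ (p ℕ.* d ∣ g)) → g ∣ d
  divisor-tight {d} g≢0 (divides t refl) no-prime with t ℕ.≟ 1
  ... | yes refl = ∣-reflexive (ℕP.*-identityˡ d)
  ... | no t≢1 with prime-factor t (λ { refl → g≢0 refl }) t≢1
  ...   | p , pp , p∣t = ⊥-elim (no-prime pp (*-monoˡ-∣ d p∣t))

  gcd-sublist : ∀ {n} → n ≢ 0 → ∀ xs ls → (∀ {x} → x ∈ ls → x ∈ xs) →
    (∀ {p} → Prime p → p ∣ n →
       All (p ℕ.* gcdAll n xs ∣_) xs ⊎ Any (λ l → ¬ (p ℕ.* gcdAll n xs ∣ l)) ls) →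
    gcdAll n ls ∣ gcdAll n xs
  gcd-sublist {n} n≢0 xs ls ls⊆xs tests =
    divisor-tight (gcdAll≢0 ls n≢0) D∣G no-prime
    where
    D = gcdAll n xs
    G = gcdAll n ls

    D∣G : D ∣ G
    D∣G = gcdAll-greatest ls (gcdAll∣n n xs) (All.tabulate (λ l∈ → gcdAll∣∈ n (ls⊆xs l∈)))

    no-prime : ∀ {p} → Prime p → ¬ (p ℕ.* D ∣ G)
    no-prime {p} pp pD∣G with tests pp (∣-trans (m∣m*n D) (∣-trans pD∣G (gcdAll∣n n ls)))
    ... | inj₁ pD∣xs =
      prime-multiple-∤ pp (gcdAll≢0 xs n≢0)
        (gcdAll-greatest xs (∣-trans pD∣G (gcdAll∣n n ls)) pD∣xs)
    ... | inj₂ some-l with find some-l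
    ...   | l , l∈ , pD∤l = pD∤l (∣-trans pD∣G (gcdAll∣∈ n l∈))

-- Residue classes [n] = n mod m form a quotient of the semiring ℕ, which
-- gives the ring laws; the ideal of ℤ/mℤ generated by a set S is generated by the
-- class of gcd(m, S), and by Bézout already by a sublist with one member per prime
-- divisor of m.
module Residues (m : ℕ) .{{_ : NonZero m}} where
  open import Data.Fin using (Fin; toℕ)
  open import Data.Fin.Properties using (toℕ-injective; toℕ-fromℕ<; toℕ<n)
  open import Data.Nat.DivMod using (_%_; _mod_; %-distribˡ-+; %-distribˡ-*; m<n⇒m%n≡m; [m+n]%n≡m%n)
  open import Data.Nat.Divisibility using (_∣_; divides; _∣?_; ∣-trans; ∣⇒≤)
  open import Data.Nat.GCD using (gcd; gcd-GCD; module Bézout)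
  open import Data.Nat.Primality using (Prime; prime?)
  open import Data.List.Membership.Propositional.Properties using (∈-map⁺; ∈-map⁻; ∈-filter⁺; ∈-upTo⁺; ∈-allFin)
  import Data.List.Relation.Unary.Any.Properties as AnyP
  open import Relation.Nullary.Decidable using (_×-dec_)
  open NumberTheory
  open Coeffs (Zmod m) using () renaming (_+_ to _⊕_; _*_ to _⊛_)

  [_] : ℕ → Fin m
  [ n ] = n mod m

  toℕ-[] : ∀ n → toℕ [ n ] ≡ n % m
  toℕ-[] n = toℕ-fromℕ< _

  []-cong : ∀ {x y} → x % m ≡ y % m → [ x ] ≡ [ y ]
  []-cong {x} {y} eq = toℕ-injective (trans (toℕ-[] x) (trans eq (sym (toℕ-[] y))))

  []-toℕ : ∀ a → [ toℕ a ] ≡ a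
  []-toℕ a = toℕ-injective (trans (toℕ-[] (toℕ a)) (m<n⇒m%n≡m (toℕ<n a)))

  class-ind : {P : Fin m → Set} → (∀ n → P [ n ]) → ∀ a → P a
  class-ind {P} P[n] a = subst P ([]-toℕ a) (P[n] (toℕ a))

  []-+ : ∀ x y → [ x ℕ.+ y ] ≡ [ x ] ⊕ [ y ]
  []-+ x y = []-cong (trans (%-distribˡ-+ x y m)
                            (sym (cong₂ (λ a b → (a ℕ.+ b) % m) (toℕ-[] x) (toℕ-[] y))))

  []-* : ∀ x y → [ x ℕ.* y ] ≡ [ x ] ⊛ [ y ]
  []-* x y = []-cong (trans (%-distribˡ-* x y m)
                            (sym (cong₂ (λ a b → (a ℕ.* b) % m) (toℕ-[] x) (toℕ-[] y))))

  [m]≡[0] : [ m ] ≡ [ 0 ]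
  [m]≡[0] = []-cong ([m+n]%n≡m%n 0 m)

  -ₘ_ : Fin m → Fin m
  -ₘ a = [ m ℕ.∸ toℕ a ]

  Zmod-laws : CommRingLaws (Zmod m)
  Zmod-laws = record
    { -_ = -ₘ_ ; 1# = [ 1 ]
    ; +-assoc = class-ind λ x → class-ind λ y → class-ind λ z → begin
        ([ x ] ⊕ [ y ]) ⊕ [ z ]   ≡⟨ cong (_⊕ [ z ]) ([]-+ x y) ⟨
        [ x ℕ.+ y ] ⊕ [ z ]       ≡⟨ []-+ (x ℕ.+ y) z ⟨
        [ (x ℕ.+ y) ℕ.+ z ]       ≡⟨ cong [_] (ℕP.+-assoc x y z) ⟩
        [ x ℕ.+ (y ℕ.+ z) ]       ≡⟨ []-+ x (y ℕ.+ z) ⟩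
        [ x ] ⊕ [ y ℕ.+ z ]       ≡⟨ cong ([ x ] ⊕_) ([]-+ y z) ⟩
        [ x ] ⊕ ([ y ] ⊕ [ z ])   ∎
    ; +-comm = class-ind λ x → class-ind λ y → begin
        [ x ] ⊕ [ y ]    ≡⟨ []-+ x y ⟨
        [ x ℕ.+ y ]      ≡⟨ cong [_] (ℕP.+-comm x y) ⟩
        [ y ℕ.+ x ]      ≡⟨ []-+ y x ⟩
        [ y ] ⊕ [ x ]    ∎
    ; +-identityˡ = class-ind λ x → sym ([]-+ 0 x)
    ; -‿inverseˡ = λ a → begin
        (-ₘ a) ⊕ a                   ≡⟨ cong ((-ₘ a) ⊕_) ([]-toℕ a) ⟨
        [ m ℕ.∸ toℕ a ] ⊕ [ toℕ a ]  ≡⟨ []-+ (m ℕ.∸ toℕ a) (toℕ a) ⟨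
        [ (m ℕ.∸ toℕ a) ℕ.+ toℕ a ]  ≡⟨ cong [_] (ℕP.m∸n+n≡m (ℕP.<⇒≤ (toℕ<n a))) ⟩
        [ m ]                        ≡⟨ [m]≡[0] ⟩
        [ 0 ]                        ∎
    ; *-assoc = class-ind λ x → class-ind λ y → class-ind λ z → begin
        ([ x ] ⊛ [ y ]) ⊛ [ z ]   ≡⟨ cong (_⊛ [ z ]) ([]-* x y) ⟨
        [ x ℕ.* y ] ⊛ [ z ]       ≡⟨ []-* (x ℕ.* y) z ⟨
        [ (x ℕ.* y) ℕ.* z ]       ≡⟨ cong [_] (ℕP.*-assoc x y z) ⟩
        [ x ℕ.* (y ℕ.* z) ]       ≡⟨ []-* x (y ℕ.* z) ⟩
        [ x ] ⊛ [ y ℕ.* z ]       ≡⟨ cong ([ x ] ⊛_) ([]-* y z) ⟩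
        [ x ] ⊛ ([ y ] ⊛ [ z ])   ∎
    ; *-comm = class-ind λ x → class-ind λ y → begin
        [ x ] ⊛ [ y ]    ≡⟨ []-* x y ⟨
        [ x ℕ.* y ]      ≡⟨ cong [_] (ℕP.*-comm x y) ⟩
        [ y ℕ.* x ]      ≡⟨ []-* y x ⟩
        [ y ] ⊛ [ x ]    ∎
    ; *-identityˡ = class-ind λ x → trans (sym ([]-* 1 x)) (cong [_] (ℕP.*-identityˡ x))
    ; distribʳ = class-ind λ x → class-ind λ y → class-ind λ z → begin
        ([ y ] ⊕ [ z ]) ⊛ [ x ]           ≡⟨ cong (_⊛ [ x ]) ([]-+ y z) ⟨
        [ y ℕ.+ z ] ⊛ [ x ]               ≡⟨ []-* (y ℕ.+ z) x ⟨
        [ (y ℕ.+ z) ℕ.* x ]               ≡⟨ cong [_] (ℕP.*-distribʳ-+ x y z) ⟩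
        [ y ℕ.* x ℕ.+ z ℕ.* x ]           ≡⟨ []-+ (y ℕ.* x) (z ℕ.* x) ⟩
        [ y ℕ.* x ] ⊕ [ z ℕ.* x ]         ≡⟨ cong₂ _⊕_ ([]-* y x) ([]-* z x) ⟩
        ([ y ] ⊛ [ x ]) ⊕ ([ z ] ⊛ [ x ]) ∎
    ; *-zeroˡ = class-ind λ x → sym ([]-* 0 x)
    }
    where open ≡-Reasoning

  open LinearAlgebra (Zmod m) Zmod-laws

  vec : ℕ → Vc 1
  vec n = [ n ] ∷ []

  val : Vc 1 → ℕ
  val (a ∷ []) = toℕ a

  vec-val : ∀ v → vec (val v) ≡ v
  vec-val (a ∷ []) = cong (_∷ []) ([]-toℕ a)

  -- Bézout with natural coefficients: a + y·b = x·c gives [a] = x·[c] - y·[b].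
  bezout-span : ∀ {X : Vc 1 → Set} {a b c} x y → a ℕ.+ y ℕ.* b ≡ x ℕ.* c →
                Span X (vec c) → Span X (vec b) → Span X (vec a)
  bezout-span {a = a} {b} {c} x y eq sc sb =
    subst (Span _) (sym (add≡⇒sub vec-eq)) (span-sub (span-smul [ x ] sc) (span-smul [ y ] sb))
    where
    vec-eq : add (vec a) (smul [ y ] (vec b)) ≡ smul [ x ] (vec c)
    vec-eq = cong (_∷ []) (begin
      [ a ] ⊕ ([ y ] ⊛ [ b ])  ≡⟨ cong ([ a ] ⊕_) ([]-* y b) ⟨
      [ a ] ⊕ [ y ℕ.* b ]      ≡⟨ []-+ a (y ℕ.* b) ⟨
      [ a ℕ.+ y ℕ.* b ]        ≡⟨ cong [_] eq ⟩
      [ x ℕ.* c ]              ≡⟨ []-* x c ⟩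
      [ x ] ⊛ [ c ]            ∎)
      where open ≡-Reasoning

  gcd-in-span : ∀ Ls → Span (_∈ Ls) (vec (gcdAll m (L.map val Ls)))
  gcd-in-span [] = subst (Span _) (cong (_∷ []) (sym [m]≡[0])) span-zero
  gcd-in-span (l ∷ Ls) = combine (Bézout.identity (gcd-GCD (val l) G′))
    where
    G′ = gcdAll m (L.map val Ls)

    span-l : Span (_∈ l ∷ Ls) (vec (val l))
    span-l = subst (Span _) (sym (vec-val l)) (span-elem (here refl))

    span-G′ : Span (_∈ l ∷ Ls) (vec G′)
    span-G′ = span-trans (λ y y∈ → span-elem (there y∈)) (gcd-in-span Ls)

    combine : Bézout.Identity (gcd (val l) G′) (val l) G′ →
              Span (_∈ l ∷ Ls) (vec (gcd (val l) G′))
    combine (Bézout.+- x y eq) = bezout-span x y eq span-l span-G′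
    combine (Bézout.-+ x y eq) = bezout-span y x eq span-G′ span-l

  allVectors : List (Vc 1)
  allVectors = L.map (_∷ []) (L.allFin m)

  ∈-allVectors : ∀ v → v ∈ allVectors
  ∈-allVectors (a ∷ []) = ∈-map⁺ (_∷ []) (∈-allFin a)

  primeDivisors : List ℕ
  primeDivisors = L.filter (λ p → prime? p ×-dec (p ∣? m)) (L.upTo (ℕ.suc m))

  ∈-primeDivisors : ∀ {p} → Prime p → p ∣ m → p ∈ primeDivisors
  ∈-primeDivisors pp p∣m = ∈-filter⁺ (λ p → prime? p ×-dec (p ∣? m)) (∈-upTo⁺ (s≤s (∣⇒≤ p∣m))) (pp , p∣m)

  members : ExcludedMiddle 0ℓ → (Vc 1 → Set) → List (Vc 1)
  members em R = L.filter (λ v → em {R v}) allVectors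

  members⊆ : (em : ExcludedMiddle 0ℓ) (R : Vc 1 → Set) → All R (members em R)
  members⊆ em R = AllP.all-filter (λ v → em {R v}) allVectors

  ∈-members : (em : ExcludedMiddle 0ℓ) {R : Vc 1 → Set} {v : Vc 1} → R v → v ∈ members em R
  ∈-members em {R} {v} Rv = ∈-filter⁺ (λ v → em {R v}) (∈-allVectors v) Rv

  -- ⟨R⟩ is generated by [gcd(m, Xs)] for Xs the members of R. Keeping one member of Xs
  -- per prime divisor p of m that is not divisible by p·gcd(m, Xs) keeps the gcd.
  Zmod-small-generating₁ : ExcludedMiddle 0ℓ → SmallGenerating (Zmod m) (numPrimeDivisors m) 1
  Zmod-small-generating₁ em R
    with counterexamples (λ p x → p ℕ.* gcdAll m (L.map val (members em R)) ∣? val x)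
                         (members em R) primeDivisors
  ... | Ls , Ls⊆Xs , |Ls|≤ , tests =
    Ls , All.tabulate (λ l∈ → All.lookup Xs⊆R (Ls⊆Xs l∈)) ,
    subst (length Ls ≤_) (sym (ℕP.*-identityʳ _)) |Ls|≤ ,
    λ x → mk⇔ (span-trans (λ y y∈ → span-elem (All.lookup Xs⊆R (Ls⊆Xs y∈))))
              (span-trans R⊆⟨Ls⟩)
    where
    Xs = members em R
    D = gcdAll m (L.map val Xs)
    G = gcdAll m (L.map val Ls)

    Xs⊆R : All R Xs
    Xs⊆R = members⊆ em R

    vals⊆ : ∀ {n} → n ∈ L.map val Ls → n ∈ L.map val Xs
    vals⊆ n∈ with ∈-map⁻ val n∈
    ... | l , l∈ , refl = ∈-map⁺ val (Ls⊆Xs l∈)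

    G∣D : G ∣ D
    G∣D = gcd-sublist (ℕ.≢-nonZero⁻¹ m) (L.map val Xs) (L.map val Ls) vals⊆
            (λ pp p∣m → Sum.map AllP.map⁺ AnyP.map⁺ (tests (∈-primeDivisors pp p∣m)))

    R⊆⟨Ls⟩ : ∀ r → R r → Span (_∈ Ls) r
    R⊆⟨Ls⟩ r Rr with ∣-trans G∣D (gcdAll∣∈ m (∈-map⁺ val (∈-members em Rr)))
    ... | divides q val-r≡ =
      subst (Span _) r≡ (span-smul [ q ] (gcd-in-span Ls))
      where
      r≡ : smul [ q ] (vec G) ≡ r
      r≡ = begin
        smul [ q ] (vec G)  ≡⟨ cong (_∷ []) ([]-* q G) ⟨
        vec (q ℕ.* G)       ≡⟨ cong vec val-r≡ ⟨
        vec (val r)         ≡⟨ vec-val r ⟩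
        r                   ∎
        where open ≡-Reasoning

lemma4 : ExcludedMiddle 0ℓ →
    ((k : ℕ) → 0 < k → SmallGenerating ℚ-coeffs 1 k) ×
    ((m k : ℕ) .{{_ : NonZero m}} → 0 < k →
      SmallGenerating (Zmod m) (numPrimeDivisors m) k)
lemma4 em =
  (λ k _ → LinearAlgebra.small-generating ℚ-coeffs Rationals.ℚ-laws 1
             (Rationals.ℚ-small-generating₁ em) k) ,
  (λ m k _ → LinearAlgebra.small-generating (Zmod m) (Residues.Zmod-laws m) (numPrimeDivisors m)
               (Residues.Zmod-small-generating₁ m em) k)
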